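{- Let $p$ be an H-PCL formula with no occurrence of the standard implication $\rightarrow$. Then $p\vdash\lambda(p)$ is provable in PCL if and only if the contract automaton $\llbracket p\rrbracket$ admits weak agreement.
   Context: Contract automata: fix disjoint sets $\mathbb{R}$ (requests $a$) and $\mathbb{O}$ (offers $\overline a$), idle symbol $\Box$, $\Sigma=\mathbb{R}\cup\mathbb{O}\cup\{\Box\}$, $co$ swapping $a,\overline a$ and fixing $\Box$. $\vec a\in\Sigma^n$ is a request/offer on $\alpha$ if it is $\Box^{n_1}\alpha\Box^{n_2}$ with $\alpha\in\mathbb{R}$/$\mathbb{O}$, a match if $\Box^{n_1}\alpha\Box^{n_2}co(\alpha)\Box^{n_3}$; $\vec a\bowtie\vec b$ iff $\vec a$ is a request or offer on some $\alpha$ and $\vec b$ is respectively an offer or request on $co(\alpha)$. A CA of rank $n$ is $\langle Q,\vec q_0,A^r,A^o,T,F\rangle$, $Q=Q_1\times\cdots\times Q_n$, transition labels in $(A^r\cup A^o\cup\{\Box\})^n$ being requests, offers or matches, idle components not changing state; its language consists of label words of paths from $\vec q_0$ to $F$. Product of CAs of ranks $r_i$: states are concatenations, initial/final componentwise, transitions are either (i) a joint move of components $i<j$ with complementary labels, label $\Box^u\vec a_i\Box^v\vec a_j\Box^z$ padded to total rank, or (ii) a move of a single component $i$ padded by idles, allowed only if no other component has, in its current state, a transition with label complementary to $\vec a_i$. $\boxtimes$ (a-product) is the product of all rank-1 projections of the operands. Weak agreement: $\mathfrak{W}$ is the set of words $\vec a_1\ldots\vec a_m$ of rank $>1$ for which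 there is $f:[1..m]\to[1..m]$ total and injective on the indices of request actions with $f(i)=j$ only if $\vec a_i\bowtie\vec a_j$; a CA admits weak agreement iff its language meets $\mathfrak{W}$. H-PCL formulae: $p::=\bigwedge_{i\in I}\alpha_i$, $\alpha::=\bigwedge_{j\in J}a_j\mid(\bigwedge_{j\in J}a_j)\rightarrow b\mid(\bigwedge_{j\in J}a_j)\twoheadrightarrow b$, $|I|\ge2$, $|J|\ge1$, distinct $a_j$, $a_j\ne b$. $\lambda(p)$ is the conjunction of all atoms in $p$. Translation with $\mathcal{P}=\{q\cup\{\ast\}\mid q\subseteq J\}$: $\llbracket\bigwedge_i\alpha_i\rrbracket=\boxtimes_i\llbracket\alpha_i\rrbracket$; $\llbracket\bigwedge_j a_j\rrbracket$ has the single (initial and final) state $\{\ast\}$ and loops $(\{\ast\},\overline{a_j},\{\ast\})$; $\llbracket(\bigwedge_j a_j)\rightarrow b\rrbracket$ has states $\mathcal{P}$, initial $J\cup\{\ast\}$, final $\{\ast\}$, transitions $(J'\cup\{j\},a_j,J')$ ($j\in J$, $j\notin J'\in\mathcal P$) and $(\{\ast\},\overline b,\{\ast\})$; $\llbracket(\bigwedge_j a_j)\twoheadrightarrow b\rrbracket$ is the same but with loops $(q,\overline b,q)$ at every $q\in\mathcal{P}$. PCL sequent calculus: the intuitionistic rules $id$ ($\Gamma,p\vdash p$), $\wedge L1,\wedge L2,\wedge R,\vee L,\vee R1,\vee R2,cut$, $\rightarrow L$ (from $\Gamma,p\rightarrow q\vdash p$ and $\Gamma,p\rightarrow q,q\vdash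 r$ infer $\Gamma,p\rightarrow q\vdash r$), $\rightarrow R$, $\neg L$ (from $\Gamma,\neg p\vdash p$ infer $\Gamma,\neg p\vdash r$), $\neg R$ (from $\Gamma,p\vdash\bot$ infer $\Gamma\vdash\neg p$), $\bot L$, $\top R$, $weakR$ (from $\Gamma\vdash\bot$ infer $\Gamma\vdash p$), plus $Zero$: from $\Gamma\vdash q$ infer $\Gamma\vdash p\twoheadrightarrow q$; $Fix$: from $\Gamma,p\twoheadrightarrow q,r\vdash p$ and $\Gamma,p\twoheadrightarrow q,q\vdash r$ infer $\Gamma,p\twoheadrightarrow q\vdash r$; $PrePost$: from $\Gamma,p\twoheadrightarrow q,p'\vdash p$ and $\Gamma,p\twoheadrightarrow q,q\vdash q'$ infer $\Gamma,p\twoheadrightarrow q\vdash p'\twoheadrightarrow q'$. -}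

module Defs where

open import Data.Nat using (ℕ; zero; suc) renaming (_<_ to _<ℕ_; _≤_ to _≤ℕ_)
open import Data.Fin using (Fin) renaming (_<_ to _<F_)
open import Data.List using (List; []; _∷_; _++_; map; concatMap; length; lookup; [_])
open import Data.List.Relation.Unary.All using (All)
open import Data.List.Relation.Unary.Unique.Propositional using (Unique)
import Data.List.Membership.Propositional as LM
open import Data.Vec using (Vec) renaming (lookup to vlookup)
open import Data.Fin.Subset using (Subset; inside; _∉_) renaming (⊤ to fullS; ⊥ to emptyS)
open import Data.Vec using (_[_]≔_)
open import Data.Unit using (⊤; tt)
open import Data.Product using (Σ; ∃; _×_; _,_)
open import Data.Sum using (_⊎_)
open import Relation.Nullary using (¬_)
open import Relation.Binary.PropositionalEquality using (_≡_; _≢_)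

infixr 6 _∧_
infixr 5 _∨_
infixr 4 _⇒_ _↠_

data Formula (A : Set) : Set where
  atom   : A → Formula A
  ⊤F ⊥F  : Formula A
  _∧_ _∨_ _⇒_ _↠_ : Formula A → Formula A → Formula A
  ¬F     : Formula A → Formula A

-- Contexts are lists read as sets: "Γ , p" in a premise/conclusion where
-- p is principal is rendered as "p ∈ Γ" (the principal formula is kept,
-- as in the given →L, ¬L, Fix, PrePost rules); "Γ , p" in a premise
-- where p is new is rendered as "p ∷ Γ".
infix 2 _⊢_
data _⊢_ {A : Set} : List (Formula A) → Formula A → Set where
  id      : ∀ {Γ p} → p LM.∈ Γ → Γ ⊢ p
  ∧L1     : ∀ {Γ p q r} → (p ∧ q) LM.∈ Γ → p ∷ Γ ⊢ r → Γ ⊢ r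
  ∧L2     : ∀ {Γ p q r} → (p ∧ q) LM.∈ Γ → q ∷ Γ ⊢ r → Γ ⊢ r
  ∧R      : ∀ {Γ p q} → Γ ⊢ p → Γ ⊢ q → Γ ⊢ p ∧ q
  ∨L      : ∀ {Γ p q r} → (p ∨ q) LM.∈ Γ → p ∷ Γ ⊢ r → q ∷ Γ ⊢ r → Γ ⊢ r
  ∨R1     : ∀ {Γ p q} → Γ ⊢ p → Γ ⊢ p ∨ q
  ∨R2     : ∀ {Γ p q} → Γ ⊢ q → Γ ⊢ p ∨ q
  cut     : ∀ {Γ p r} → Γ ⊢ p → p ∷ Γ ⊢ r → Γ ⊢ r
  ⇒L      : ∀ {Γ p q r} → (p ⇒ q) LM.∈ Γ → Γ ⊢ p → q ∷ Γ ⊢ r → Γ ⊢ r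
  ⇒R      : ∀ {Γ p q} → p ∷ Γ ⊢ q → Γ ⊢ p ⇒ q
  ¬L      : ∀ {Γ p r} → ¬F p LM.∈ Γ → Γ ⊢ p → Γ ⊢ r
  ¬R      : ∀ {Γ p} → p ∷ Γ ⊢ ⊥F → Γ ⊢ ¬F p
  ⊥L      : ∀ {Γ r} → ⊥F LM.∈ Γ → Γ ⊢ r
  ⊤R      : ∀ {Γ} → Γ ⊢ ⊤F
  weakR   : ∀ {Γ p} → Γ ⊢ ⊥F → Γ ⊢ p
  Zero    : ∀ {Γ p q} → Γ ⊢ q → Γ ⊢ p ↠ q
  Fix     : ∀ {Γ p q r} → (p ↠ q) LM.∈ Γ → r ∷ Γ ⊢ p → q ∷ Γ ⊢ r → Γ ⊢ r
  PrePost : ∀ {Γ p q p' q'} → (p ↠ q) LM.∈ Γ → p' ∷ Γ ⊢ p → q ∷ Γ ⊢ q'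
            → Γ ⊢ p' ↠ q'

⋀ : {A : Set} → List (Formula A) → Formula A
⋀ []           = ⊤F
⋀ (x ∷ [])     = x
⋀ (x ∷ y ∷ xs) = x ∧ ⋀ (y ∷ xs)

data Clause (A : Set) : Set where
  conj : List A → Clause A
  imp  : List A → A → Clause A
  cimp : List A → A → Clause A

HPCL : Set → Set
HPCL A = List (Clause A)

data WFClause {A : Set} : Clause A → Set where
  conj : ∀ {a as} → Unique (a ∷ as) → WFClause (conj (a ∷ as))
  imp  : ∀ {a as b} → Unique (a ∷ as) → ¬ (b LM.∈ (a ∷ as)) → WFClause (imp (a ∷ as) b)
  cimp : ∀ {a as b} → Unique (a ∷ as) → ¬ (b LM.∈ (a ∷ as)) → WFClause (cimp (a ∷ as) b)

WellFormed : {A : Set} → HPCL A → Set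
WellFormed p = (2 ≤ℕ length p) × All WFClause p

data IsStdImp {A : Set} : Clause A → Set where
  isImp : ∀ {as b} → IsStdImp (imp as b)

NoStdImp : {A : Set} → HPCL A → Set
NoStdImp p = All (λ c → ¬ IsStdImp c) p

clauseFormula : {A : Set} → Clause A → Formula A
clauseFormula (conj as)   = ⋀ (map atom as)
clauseFormula (imp as b)  = ⋀ (map atom as) ⇒ atom b
clauseFormula (cimp as b) = ⋀ (map atom as) ↠ atom b

toPCL : {A : Set} → HPCL A → Formula A
toPCL p = ⋀ (map clauseFormula p)

clauseAtoms : {A : Set} → Clause A → List A
clauseAtoms (conj as)   = as
clauseAtoms (imp as b)  = as ++ [ b ]
clauseAtoms (cimp as b) = as ++ [ b ]

λF : {A : Set} → HPCL A → Formula A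
λF p = ⋀ (map atom (concatMap clauseAtoms p))

data Act (A : Set) : Set where
  req off : A → Act A

co : {A : Set} → Act A → Act A
co (req a) = off a
co (off a) = req a

data Sym (A : Set) : Set where
  act  : Act A → Sym A
  idle : Sym A

Label : Set → ℕ → Set
Label A n = Vec (Sym A) n

record CA (A : Set) (n : ℕ) : Set₁ where
  field
    State : Set
    init  : State
    Final : State → Set
    Trans : State → Label A n → State → Set

-- a contract automaton of rank 1 (a principal); its labels are
-- requests or offers, i.e. never □
record CA₁ (A : Set) : Set₁ where
  field
    State : Set
    init  : State
    Final : State → Set
    Trans : State → Act A → State → Set

data Run {A : Set} {n : ℕ} (C : CA A n) : CA.State C → List (Label A n) → Set where
  done : ∀ {q} → CA.Final C q → Run C q []
  step : ∀ {q a q' w} → CA.Trans C q a q' → Run C q' w → Run C q (a ∷ w)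

Language : {A : Set} {n : ℕ} → CA A n → List (Label A n) → Set
Language C w = Run C (CA.init C) w

ReqOn : {A : Set} {n : ℕ} → Label A n → A → Set
ReqOn {n = n} v x = Σ (Fin n) λ i → (vlookup v i ≡ act (req x))
                      × (∀ l → l ≢ i → vlookup v l ≡ idle)

OffOn : {A : Set} {n : ℕ} → Label A n → A → Set
OffOn {n = n} v x = Σ (Fin n) λ i → (vlookup v i ≡ act (off x))
                      × (∀ l → l ≢ i → vlookup v l ≡ idle)

IsRequest : {A : Set} {n : ℕ} → Label A n → Set
IsRequest v = ∃ λ x → ReqOn v x

_⋈_ : {A : Set} {n : ℕ} → Label A n → Label A n → Set
v ⋈ u = (∃ λ x → ReqOn v x × OffOn u x) ⊎ (∃ λ x → OffOn v x × ReqOn u x)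

InW : {A : Set} {n : ℕ} → List (Label A n) → Set
InW {n = n} w =
  (1 <ℕ n) ×
  Σ (Fin (length w) → Fin (length w)) λ f →
    (∀ i → IsRequest (lookup w i) → lookup w i ⋈ lookup w (f i)) ×
    (∀ i j → IsRequest (lookup w i) → IsRequest (lookup w j) → f i ≡ f j → i ≡ j)

AdmitsWeakAgreement : {A : Set} {n : ℕ} → CA A n → Set
AdmitsWeakAgreement {A} {n} C = Σ (List (Label A n)) λ w → Language C w × InW w

-- product of k principals (= a-product, since the rank-1 projection of a
-- rank-1 automaton is the automaton itself)
product : {A : Set} {k : ℕ} → (Fin k → CA₁ A) → CA A k
product {A} {k} P = record
  { State = (i : Fin k) → CA₁.State (P i)
  ; init  = λ i → CA₁.init (P i)
  ; Final = λ q → ∀ i → CA₁.Final (P i) (q i)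
  ; Trans = λ q ℓ q' → joint q ℓ q' ⊎ single q ℓ q'
  }
  where
  St : Set
  St = (i : Fin k) → CA₁.State (P i)
  joint : St → Label A k → St → Set
  joint q ℓ q' = Σ (Fin k) λ i → Σ (Fin k) λ j → (i <F j) × Σ (Act A) λ x →
      CA₁.Trans (P i) (q i) x (q' i)
    × CA₁.Trans (P j) (q j) (co x) (q' j)
    × (∀ l → l ≢ i → l ≢ j → q' l ≡ q l)
    × (vlookup ℓ i ≡ act x) × (vlookup ℓ j ≡ act (co x))
    × (∀ l → l ≢ i → l ≢ j → vlookup ℓ l ≡ idle)
  single : St → Label A k → St → Set
  single q ℓ q' = Σ (Fin k) λ i → Σ (Act A) λ x →
      CA₁.Trans (P i) (q i) x (q' i)
    × (∀ l → l ≢ i → q' l ≡ q l)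
    × (vlookup ℓ i ≡ act x)
    × (∀ l → l ≢ i → vlookup ℓ l ≡ idle)
    × (∀ j → j ≢ i → ∀ r → ¬ CA₁.Trans (P j) (q j) (co x) r)

-- States of 𝒫 = { q ∪ {∗} | q ⊆ J } are represented by subsets of the
-- index set of J (∗ implicit); J ∪ {∗} is the full subset, {∗} the empty one.
⟦_⟧c : {A : Set} → Clause A → CA₁ A
⟦ conj as ⟧c = record
  { State = ⊤ ; init = tt ; Final = λ _ → ⊤
  ; Trans = λ _ x _ → ∃ λ a → (x ≡ off a) × (a LM.∈ as) }
⟦ imp as b ⟧c = record
  { State = Subset (length as) ; init = fullS ; Final = λ q → q ≡ emptyS
  ; Trans = λ q x q' →
      (Σ (Fin (length as)) λ j → (x ≡ req (lookup as j)) × (j ∉ q') × (q ≡ q' [ j ]≔ inside))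
      ⊎ ((x ≡ off b) × (q ≡ emptyS) × (q' ≡ emptyS)) }
⟦ cimp as b ⟧c = record
  { State = Subset (length as) ; init = fullS ; Final = λ q → q ≡ emptyS
  ; Trans = λ q x q' →
      (Σ (Fin (length as)) λ j → (x ≡ req (lookup as j)) × (j ∉ q') × (q ≡ q' [ j ]≔ inside))
      ⊎ ((x ≡ off b) × (q' ≡ q)) }

⟦_⟧ : {A : Set} → (p : HPCL A) → CA A (length p)
⟦ p ⟧ = product (λ i → ⟦ lookup p i ⟧c)

module Submission where

-- Both sides are equivalent to: every atom of p is offered by some clause, i.e. it
-- is a conjunct of a plain conjunction or the consequent of a ↠-clause.
-- Provability: a derivation is sound for the valuation making exactly the offered
-- atoms true (with p ↠ q read as q), under which toPCL p holds; conversely Fix lets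
-- one assume the consequent of every ↠-clause while proving λ(p).
-- Weak agreement: every offer in a run of ⟦ p ⟧ is on an offered atom, and weak
-- agreement matches every request with an offer, so all requests are on offered
-- atoms; a ↠-component must request all its antecedents before becoming final.
-- Conversely each component can issue its requests in joint moves against the offer
-- loops of the other components; the resulting run consists of matches only, so it
-- lies in 𝔚 with f the identity.

open import Defs
open import Data.Bool using (true; false)
open import Data.Empty using (⊥; ⊥-elim)
open import Data.Fin using (Fin; zero; suc)
open import Data.Fin.Properties using (_≟_; <-cmp)
open import Data.Fin.Subset using (Subset; inside; _∉_) renaming (⊤ to fullS; ⊥ to emptyS)
open import Data.List using (List; []; _∷_; [_]; map; concatMap; length; lookup; allFin)
open import Data.List.Membership.Propositional using (_∈_; lose)
open import Data.List.Membership.Propositional.Properties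
  using (∈-map⁺; ∈-++⁺ˡ; ∈-++⁻; ∈-concatMap⁺; ∈-concatMap⁻; ∈-lookup; ∈-allFin)
open import Data.List.Relation.Binary.Subset.Propositional using (_⊆_)
open import Data.List.Relation.Binary.Subset.Propositional.Properties using (xs⊆x∷xs; ∷⁺ʳ)
  renaming (map⁺ to ⊆-map⁺)
open import Data.List.Relation.Unary.All as All using (All; []; _∷_)
open import Data.List.Relation.Unary.All.Properties using () renaming (map⁺ to All-map⁺; map⁻ to All-map⁻)
open import Data.List.Relation.Unary.Any using (Any; here; there; index)
open import Data.List.Relation.Unary.Any.Properties using (lookup-index)
open import Data.Nat using (ℕ)
open import Data.Product using (Σ; _×_; _,_; proj₁; proj₂)
open import Data.Sum using (_⊎_; inj₁; inj₂)
open import Data.Unit using (⊤; tt)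
open import Data.Vec using ([]; _∷_; replicate; _[_]≔_) renaming (lookup to vlookup)
open import Data.Vec.Base using (there)
open import Data.Vec.Properties using (lookup∘update; lookup∘update′; lookup-replicate)
open import Function using (_∘_; flip)
open import Function.Bundles using (_⇔_; mk⇔)
import Function.Properties.Equivalence as ⇔
open import Relation.Binary.Definitions using (tri<; tri≈; tri>)
open import Relation.Binary.PropositionalEquality using (_≡_; _≢_; refl; sym; trans; cong; subst)
open import Relation.Nullary using (¬_; yes; no)

module _ {A : Set} where

  private variable
    Γ Δ : List (Formula A)
    φ ψ χ : Formula A
    xs ys : List (Formula A)

  ⊢-weaken : Γ ⊆ Δ → Γ ⊢ φ → Δ ⊢ φ
  ⊢-weaken s (id m)            = id (s m)
  ⊢-weaken s (∧L1 m d)         = ∧L1 (s m) (⊢-weaken (∷⁺ʳ _ s) d)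
  ⊢-weaken s (∧L2 m d)         = ∧L2 (s m) (⊢-weaken (∷⁺ʳ _ s) d)
  ⊢-weaken s (∧R d e)          = ∧R (⊢-weaken s d) (⊢-weaken s e)
  ⊢-weaken s (∨L m d e)        = ∨L (s m) (⊢-weaken (∷⁺ʳ _ s) d) (⊢-weaken (∷⁺ʳ _ s) e)
  ⊢-weaken s (∨R1 d)           = ∨R1 (⊢-weaken s d)
  ⊢-weaken s (∨R2 d)           = ∨R2 (⊢-weaken s d)
  ⊢-weaken s (cut d e)         = cut (⊢-weaken s d) (⊢-weaken (∷⁺ʳ _ s) e)
  ⊢-weaken s (⇒L m d e)        = ⇒L (s m) (⊢-weaken s d) (⊢-weaken (∷⁺ʳ _ s) e)
  ⊢-weaken s (⇒R d)            = ⇒R (⊢-weaken (∷⁺ʳ _ s) d)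
  ⊢-weaken s (¬L m d)          = ¬L (s m) (⊢-weaken s d)
  ⊢-weaken s (¬R d)            = ¬R (⊢-weaken (∷⁺ʳ _ s) d)
  ⊢-weaken s (⊥L m)            = ⊥L (s m)
  ⊢-weaken s ⊤R                = ⊤R
  ⊢-weaken s (weakR d)         = weakR (⊢-weaken s d)
  ⊢-weaken s (Zero d)          = Zero (⊢-weaken s d)
  ⊢-weaken s (Fix m d e)       = Fix (s m) (⊢-weaken (∷⁺ʳ _ s) d) (⊢-weaken (∷⁺ʳ _ s) e)
  ⊢-weaken s (PrePost m d e)   = PrePost (s m) (⊢-weaken (∷⁺ʳ _ s) d) (⊢-weaken (∷⁺ʳ _ s) e)

  ⊢-weaken-∷ : Γ ⊢ φ → ψ ∷ Γ ⊢ φ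
  ⊢-weaken-∷ = ⊢-weaken (xs⊆x∷xs _ _)

  ⋀-left : ⋀ xs ∈ Γ → φ ∈ xs → Γ ⊢ φ
  ⋀-left {xs = _ ∷ []}    m (here refl) = id m
  ⋀-left {xs = _ ∷ _ ∷ _} m (here refl) = ∧L1 m (id (here refl))
  ⋀-left {xs = _ ∷ _ ∷ _} m (there n)   = ∧L2 m (⋀-left (here refl) n)

  ⋀-right : All (Γ ⊢_) xs → Γ ⊢ ⋀ xs
  ⋀-right []                = ⊤R
  ⋀-right (d ∷ [])          = d
  ⋀-right (d ∷ ds@(_ ∷ _))  = ∧R d (⋀-right ds)

  ⋀-mono : ⋀ xs ∈ Γ → ys ⊆ xs → Γ ⊢ ⋀ ys
  ⋀-mono m ys⊆xs = ⋀-right (All.tabulate (⋀-left m ∘ ys⊆xs))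

  ⋀-elim : Γ ⊢ ⋀ xs → φ ∈ xs → Γ ⊢ φ
  ⋀-elim d m = cut d (⋀-left (here refl) m)

  Fix-cut : Γ ⊢ φ ↠ ψ → χ ∷ Γ ⊢ φ → ψ ∷ Γ ⊢ χ → Γ ⊢ χ
  Fix-cut d e f = cut d (Fix (here refl) (⊢-weaken (∷⁺ʳ _ (xs⊆x∷xs _ _)) e)
                                         (⊢-weaken (∷⁺ʳ _ (xs⊆x∷xs _ _)) f))

  -- Reading p ↠ q as q alone validates Zero, Fix and PrePost.
  Holds : (A → Set) → Formula A → Set
  Holds V (atom a) = V a
  Holds V ⊤F       = ⊤
  Holds V ⊥F       = ⊥
  Holds V (φ ∧ ψ)  = Holds V φ × Holds V ψ
  Holds V (φ ∨ ψ)  = Holds V φ ⊎ Holds V ψ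
  Holds V (φ ⇒ ψ)  = Holds V φ → Holds V ψ
  Holds V (φ ↠ ψ)  = Holds V ψ
  Holds V (¬F φ)   = Holds V φ → ⊥

  module _ {V : A → Set} where

    ⊢-sound : Γ ⊢ φ → All (Holds V) Γ → Holds V φ
    ⊢-sound (id m)          γ = All.lookup γ m
    ⊢-sound (∧L1 m d)       γ = ⊢-sound d (proj₁ (All.lookup γ m) ∷ γ)
    ⊢-sound (∧L2 m d)       γ = ⊢-sound d (proj₂ (All.lookup γ m) ∷ γ)
    ⊢-sound (∧R d e)        γ = ⊢-sound d γ , ⊢-sound e γ
    ⊢-sound (∨L m d e)      γ with All.lookup γ m
    ... | inj₁ v = ⊢-sound d (v ∷ γ)
    ... | inj₂ v = ⊢-sound e (v ∷ γ)
    ⊢-sound (∨R1 d)         γ = inj₁ (⊢-sound d γ)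
    ⊢-sound (∨R2 d)         γ = inj₂ (⊢-sound d γ)
    ⊢-sound (cut d e)       γ = ⊢-sound e (⊢-sound d γ ∷ γ)
    ⊢-sound (⇒L m d e)      γ = ⊢-sound e (All.lookup γ m (⊢-sound d γ) ∷ γ)
    ⊢-sound (⇒R d)          γ = λ v → ⊢-sound d (v ∷ γ)
    ⊢-sound (¬L m d)        γ = ⊥-elim (All.lookup γ m (⊢-sound d γ))
    ⊢-sound (¬R d)          γ = λ v → ⊢-sound d (v ∷ γ)
    ⊢-sound (⊥L m)          γ = ⊥-elim (All.lookup γ m)
    ⊢-sound ⊤R              γ = tt
    ⊢-sound (weakR d)       γ = ⊥-elim (⊢-sound d γ)
    ⊢-sound (Zero d)        γ = ⊢-sound d γ
    ⊢-sound (Fix m d e)     γ = ⊢-sound e (All.lookup γ m ∷ γ)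
    ⊢-sound (PrePost m d e) γ = ⊢-sound e (All.lookup γ m ∷ γ)

    ⋀-holds⁺ : All (Holds V) xs → Holds V (⋀ xs)
    ⋀-holds⁺ []               = tt
    ⋀-holds⁺ (v ∷ [])         = v
    ⋀-holds⁺ (v ∷ vs@(_ ∷ _)) = v , ⋀-holds⁺ vs

    ⋀-holds⁻ : Holds V (⋀ xs) → All (Holds V) xs
    ⋀-holds⁻ {xs = []}        _        = []
    ⋀-holds⁻ {xs = _ ∷ []}    v        = v ∷ []
    ⋀-holds⁻ {xs = _ ∷ _ ∷ _} (v , vs) = v ∷ ⋀-holds⁻ vs

module _ {A : Set} where

  Offers : Clause A → A → Set
  Offers (conj as)  a = a ∈ as
  Offers (imp _ b)  a = a ≡ b
  Offers (cimp _ b) a = a ≡ b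

  antecedents : Clause A → List A
  antecedents (conj _)    = []
  antecedents (imp as _)  = as
  antecedents (cimp as _) = as

  Offered : List (Clause A) → A → Set
  Offered cs a = Any (λ c → Offers c a) cs

  atoms : HPCL A → List A
  atoms = concatMap clauseAtoms

  AtomsOffered : HPCL A → Set
  AtomsOffered p = All (Offered p) (atoms p)

  antecedents⊆clauseAtoms : (c : Clause A) → antecedents c ⊆ clauseAtoms c
  antecedents⊆clauseAtoms (conj _)   ()
  antecedents⊆clauseAtoms (imp _ _)  = ∈-++⁺ˡ
  antecedents⊆clauseAtoms (cimp _ _) = ∈-++⁺ˡ

  clauseAtom-antecedent-or-offered : (c : Clause A) {a : A} → a ∈ clauseAtoms c → a ∈ antecedents c ⊎ Offers c a
  clauseAtom-antecedent-or-offered (conj _)    m = inj₂ m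
  clauseAtom-antecedent-or-offered (imp as _)  m with ∈-++⁻ as m
  ... | inj₁ m′         = inj₁ m′
  ... | inj₂ (here refl) = inj₂ refl
  clauseAtom-antecedent-or-offered (cimp as _) m with ∈-++⁻ as m
  ... | inj₁ m′         = inj₁ m′
  ... | inj₂ (here refl) = inj₂ refl

  antecedents⊆atoms : {c : Clause A} {p : HPCL A} → c ∈ p → antecedents c ⊆ atoms p
  antecedents⊆atoms {c} c∈p a∈ = ∈-concatMap⁺ clauseAtoms (lose c∈p (antecedents⊆clauseAtoms c a∈))

  clause-holds : {c : Clause A} {p : HPCL A} → c ∈ p → ¬ IsStdImp c → Holds (Offered p) (clauseFormula c)
  clause-holds {conj as} {p} c∈p _ = ⋀-holds⁺ (All-map⁺ (All.tabulate {P = Offered p} (lose c∈p)))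
  clause-holds {imp _ _}  _   n = ⊥-elim (n isImp)
  clause-holds {cimp _ _} c∈p _ = lose c∈p refl

  ⊢λ⇒atomsOffered : (p : HPCL A) → NoStdImp p → [ toPCL p ] ⊢ λF p → AtomsOffered p
  ⊢λ⇒atomsOffered p nsi d = All-map⁻ (⋀-holds⁻ (⊢-sound d (toPCL-holds ∷ [])))
    where
    toPCL-holds : Holds (Offered p) (toPCL p)
    toPCL-holds = ⋀-holds⁺ (All-map⁺ (All.tabulate (λ c∈p → clause-holds c∈p (All.lookup nsi c∈p))))

  -- The ↠-clauses are discharged one at a time with Fix: while proving the
  -- target we may assume the consequent, since the target entails the antecedents.
  ⊢⋀atoms : (L : List A) (cs : List (Clause A)) {Γ : List (Formula A)} → NoStdImp cs →
            All (λ c → Γ ⊢ clauseFormula c) cs → All (λ c → antecedents c ⊆ L) cs →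
            (∀ {a} → a ∈ L → Offered cs a ⊎ Γ ⊢ atom a) → Γ ⊢ ⋀ (map atom L)
  ⊢⋀atoms L [] _ _ _ settled = ⋀-right (All-map⁺ (All.tabulate derivable))
    where
    derivable : ∀ {a} → a ∈ L → _ ⊢ atom a
    derivable m with settled m
    ... | inj₂ d = d
  ⊢⋀atoms L (conj as ∷ cs) (_ ∷ nsi) (d ∷ ds) (_ ∷ ants) settled = ⊢⋀atoms L cs nsi ds ants settled′
    where
    settled′ : ∀ {a} → a ∈ L → Offered cs a ⊎ _ ⊢ atom a
    settled′ m with settled m
    ... | inj₁ (here a∈as) = inj₂ (⋀-elim d (∈-map⁺ atom a∈as))
    ... | inj₁ (there o)   = inj₁ o
    ... | inj₂ e           = inj₂ e
  ⊢⋀atoms L (imp _ _ ∷ _) (n ∷ _) _ _ _ = ⊥-elim (n isImp)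
  ⊢⋀atoms L (cimp as b ∷ cs) (_ ∷ nsi) (d ∷ ds) (as⊆L ∷ ants) settled =
    Fix-cut d (⋀-mono (here refl) (⊆-map⁺ atom as⊆L))
              (⊢⋀atoms L cs nsi (All.map ⊢-weaken-∷ ds) ants settled′)
    where
    settled′ : ∀ {a} → a ∈ L → Offered cs a ⊎ atom b ∷ _ ⊢ atom a
    settled′ m with settled m
    ... | inj₁ (here refl) = inj₂ (id (here refl))
    ... | inj₁ (there o)   = inj₁ o
    ... | inj₂ e           = inj₂ (⊢-weaken-∷ e)

  atomsOffered⇒⊢λ : (p : HPCL A) → NoStdImp p → AtomsOffered p → [ toPCL p ] ⊢ λF p
  atomsOffered⇒⊢λ p nsi ao =
    ⊢⋀atoms (atoms p) p nsi (All.tabulate (⋀-left (here refl) ∘ ∈-map⁺ clauseFormula))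
            (All.tabulate antecedents⊆atoms) (inj₁ ∘ All.lookup ao)

  ⊢λ⇔atomsOffered : (p : HPCL A) → NoStdImp p → ([ toPCL p ] ⊢ λF p) ⇔ AtomsOffered p
  ⊢λ⇔atomsOffered p nsi = mk⇔ (⊢λ⇒atomsOffered p nsi) (atomsOffered⇒⊢λ p nsi)

module _ {A : Set} where

  private variable
    x y : Act A
    a : A

  idle≢act : idle ≢ act x
  idle≢act ()

  act-injective : act x ≡ act y → x ≡ y
  act-injective refl = refl

  co≡req⇒≡off : co x ≡ req a → x ≡ off a
  co≡req⇒≡off {x = off _} refl = refl

module _ {A : Set} {n : ℕ} where

  private variable
    v : Label A n
    a b : A
    x y : Act A
    i j l : Fin n

  ReqOn-unique : ReqOn v a → ReqOn v b → a ≡ b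
  ReqOn-unique (i , vᵢ , _) (j , vⱼ , idleⱼ) with i ≟ j
  ... | no i≢j = ⊥-elim (idle≢act (trans (sym (idleⱼ i i≢j)) vᵢ))
  ... | yes refl with trans (sym vᵢ) vⱼ
  ...   | refl = refl

  ReqOn-OffOn-disjoint : ReqOn v a → ¬ OffOn v b
  ReqOn-OffOn-disjoint (i , vᵢ , _) (j , vⱼ , idleⱼ) with i ≟ j
  ... | no i≢j = idle≢act (trans (sym (idleⱼ i i≢j)) vᵢ)
  ... | yes refl with trans (sym vᵢ) vⱼ
  ...   | ()

  two-actions⇒¬IsRequest : i ≢ j → vlookup v i ≡ act x → vlookup v j ≡ act y → ¬ IsRequest v
  two-actions⇒¬IsRequest {i = i} {j} i≢j vᵢ vⱼ (_ , m , _ , idleₘ) with m ≟ i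
  ... | yes refl = idle≢act (trans (sym (idleₘ j (i≢j ∘ sym))) vⱼ)
  ... | no m≢i   = idle≢act (trans (sym (idleₘ i (m≢i ∘ sym))) vᵢ)

  OffersIn : (A → Set) → Label A n → Set
  OffersIn O ℓ = ∀ l a → vlookup ℓ l ≡ act (off a) → O a

  RequestsIn : (A → Set) → Label A n → Set
  RequestsIn O ℓ = ∀ a → ReqOn ℓ a → O a

  InW⇒requestsIn : {O : A → Set} (w : List (Label A n)) → InW w →
                   (∀ i → OffersIn O (lookup w i)) → ∀ i → RequestsIn O (lookup w i)
  InW⇒requestsIn {O = O} w (_ , f , matched , _) offers i a reqₐ with matched i (a , reqₐ)
  ... | inj₁ (b , req-b , (l , off-b , _)) =
    subst O (sym (ReqOn-unique {v = lookup w i} reqₐ req-b)) (offers (f i) l b off-b)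
  ... | inj₂ (_ , off-b , _)              = ⊥-elim (ReqOn-OffOn-disjoint {v = lookup w i} reqₐ off-b)

  matchLabel : Fin n → Fin n → Act A → Act A → Label A n
  matchLabel i j x y = replicate n idle [ i ]≔ act x [ j ]≔ act y

  matchLabel-i : i ≢ j → vlookup (matchLabel i j x y) i ≡ act x
  matchLabel-i {i = i} {j} {x} {y} i≢j =
    trans (lookup∘update′ i≢j (replicate n idle [ i ]≔ act x) (act y))
          (lookup∘update i (replicate n idle) (act x))

  matchLabel-j : vlookup (matchLabel i j x y) j ≡ act y
  matchLabel-j {i = i} {j} {x} {y} = lookup∘update j (replicate n idle [ i ]≔ act x) (act y)

  matchLabel-idle : l ≢ i → l ≢ j → vlookup (matchLabel i j x y) l ≡ idle
  matchLabel-idle {l = l} {i} {j} {x} {y} l≢i l≢j =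
    trans (lookup∘update′ l≢j (replicate n idle [ i ]≔ act x) (act y))
          (trans (lookup∘update′ l≢i (replicate n idle) (act x)) (lookup-replicate l idle))

  matchLabel-¬IsRequest : i ≢ j → ¬ IsRequest (matchLabel i j x y)
  matchLabel-¬IsRequest {i = i} {j} {x} {y} i≢j =
    two-actions⇒¬IsRequest {v = matchLabel i j x y} i≢j (matchLabel-i i≢j) (matchLabel-j {i = i})

module _ {n : ℕ} {S : Fin n → Set} where

  private variable
    q : (i : Fin n) → S i
    i l : Fin n
    s : S i

  update : ((i : Fin n) → S i) → (i : Fin n) → S i → (l : Fin n) → S l
  update q i s l with i ≟ l
  ... | yes refl = s
  ... | no _     = q l

  update-same : update q i s i ≡ s
  update-same {i = i} with i ≟ i
  ... | yes refl = refl
  ... | no i≢i   = ⊥-elim (i≢i refl)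

  update-other : l ≢ i → update q i s l ≡ q l
  update-other {l = l} {i = i} l≢i with i ≟ l
  ... | yes refl = ⊥-elim (l≢i refl)
  ... | no _     = refl

data RequestPath {A : Set} (D : CA₁ A) (G : A → Set) : CA₁.State D → Set where
  arrived : ∀ {s} → CA₁.Final D s → RequestPath D G s
  request : ∀ {s s′ a} → CA₁.Trans D s (req a) s′ → G a → RequestPath D G s′ → RequestPath D G s

module _ {A : Set} where

  private variable
    a : A
    x : Act A
    as : List A
    O G : A → Set

  offer⇒Offers : (c : Clause A) {s s′ : CA₁.State ⟦ c ⟧c} → CA₁.Trans ⟦ c ⟧c s (off a) s′ → Offers c a
  offer⇒Offers (conj _)   (_ , refl , a∈) = a∈
  offer⇒Offers (imp _ _)  (inj₁ (_ , () , _))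
  offer⇒Offers (imp _ _)  (inj₂ (refl , _))   = refl
  offer⇒Offers (cimp _ _) (inj₁ (_ , () , _))
  offer⇒Offers (cimp _ _) (inj₂ (refl , _))   = refl

  offer-loop : (c : Clause A) → ¬ IsStdImp c → Offers c a → ∀ s → CA₁.Trans ⟦ c ⟧c s (off a) s
  offer-loop (conj _)   _ a∈  _ = _ , refl , a∈
  offer-loop (imp _ _)  n _   _ = ⊥-elim (n isImp)
  offer-loop (cimp _ _) _ refl _ = inj₂ (refl , refl)

  antecedent-not-offered : {c : Clause A} → WFClause c → a ∈ antecedents c → ¬ Offers c a
  antecedent-not-offered (imp _ b∉)  a∈ refl = b∉ a∈
  antecedent-not-offered (cimp _ b∉) a∈ refl = b∉ a∈

  private
    ∉-there : ∀ {m} {j : Fin m} {s : Subset m} {bit} → j ∉ s → suc j ∉ (bit ∷ s)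
    ∉-there j∉ (there j∈) = j∉ j∈

    request-path-false∷ : {b : A} {s : Subset (length as)} →
                          RequestPath ⟦ cimp as b ⟧c G s → RequestPath ⟦ cimp (a ∷ as) b ⟧c G (false ∷ s)
    request-path-false∷ (arrived refl) = arrived refl
    request-path-false∷ (request (inj₁ (j , refl , j∉ , refl)) g rest) =
      request (inj₁ (suc j , refl , ∉-there j∉ , refl)) g (request-path-false∷ rest)
    request-path-false∷ (request (inj₂ (() , _)) _ _)

    cimp-request-path : (as : List A) (b : A) → All G as → (s : Subset (length as)) →
                        RequestPath ⟦ cimp as b ⟧c G s
    cimp-request-path []       _ []       []          = arrived refl
    cimp-request-path (_ ∷ as) b (g ∷ gs) (true ∷ s)  =
      request (inj₁ (zero , refl , (λ ()) , refl)) g (request-path-false∷ (cimp-request-path as b gs s))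
    cimp-request-path (_ ∷ as) b (_ ∷ gs) (false ∷ s) = request-path-false∷ (cimp-request-path as b gs s)

  request-path : (c : Clause A) → ¬ IsStdImp c → (∀ {a} → a ∈ antecedents c → G a) →
                 ∀ s → RequestPath ⟦ c ⟧c G s
  request-path (conj _)    _ _ _ = arrived tt
  request-path (imp _ _)   n _ _ = ⊥-elim (n isImp)
  request-path (cimp as b) _ g   = cimp-request-path as b (All.tabulate g)

  MarkedIn : (A → Set) → (as : List A) → Subset (length as) → Set
  MarkedIn O as s = ∀ j → vlookup s j ≡ true → O (lookup as j)

  MarkedIn-empty : MarkedIn O as emptyS
  MarkedIn-empty j e with trans (sym (lookup-replicate j false)) e
  ... | ()

  MarkedIn-update : ∀ {s s′ j′} → s ≡ s′ [ j′ ]≔ inside → O (lookup as j′) →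
                    MarkedIn O as s′ → MarkedIn O as s
  MarkedIn-update {s′ = s′} {j′} refl o marked j e with j ≟ j′
  ... | yes refl = o
  ... | no j≢j′  = marked j (trans (sym (lookup∘update′ j≢j′ s′ true)) e)

  MarkedIn-full : MarkedIn O as fullS → a ∈ as → O a
  MarkedIn-full {O = O} marked a∈ =
    subst O (sym (lookup-index a∈)) (marked (index a∈) (lookup-replicate (index a∈) true))

  -- The set bits of a clause state are the antecedents still to be requested.
  OutstandingIn : (A → Set) → (c : Clause A) → CA₁.State ⟦ c ⟧c → Set
  OutstandingIn O (conj _)    _ = ⊤
  OutstandingIn O (imp as _)  s = MarkedIn O as s
  OutstandingIn O (cimp as _) s = MarkedIn O as s

  outstanding-final : (c : Clause A) {s : CA₁.State ⟦ c ⟧c} → CA₁.Final ⟦ c ⟧c s → OutstandingIn O c s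
  outstanding-final         (conj _)    _    = tt
  outstanding-final {O = O} (imp as _)  refl = MarkedIn-empty {O = O} {as}
  outstanding-final {O = O} (cimp as _) refl = MarkedIn-empty {O = O} {as}

  outstanding-step : (c : Clause A) {s s′ : CA₁.State ⟦ c ⟧c} → CA₁.Trans ⟦ c ⟧c s x s′ →
                     (∀ {a} → x ≡ req a → O a) → OutstandingIn O c s′ → OutstandingIn O c s
  outstanding-step         (conj _)    _                       _ _ = tt
  outstanding-step {O = O} (imp as _)  (inj₁ (_ , x≡ , _ , e)) h m = MarkedIn-update {O = O} {as} e (h x≡) m
  outstanding-step {O = O} (imp as _)  (inj₂ (_ , refl , _))   _ _ = MarkedIn-empty {O = O} {as}
  outstanding-step {O = O} (cimp as _) (inj₁ (_ , x≡ , _ , e)) h m = MarkedIn-update {O = O} {as} e (h x≡) m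
  outstanding-step         (cimp _ _)  (inj₂ (_ , refl))       _ m = m

  outstanding-init : (c : Clause A) → OutstandingIn O c (CA₁.init ⟦ c ⟧c) → a ∈ antecedents c → O a
  outstanding-init {O = O} (imp as _)  = MarkedIn-full {O = O} {as}
  outstanding-init {O = O} (cimp as _) = MarkedIn-full {O = O} {as}

module _ {A : Set} (p : HPCL A) where

  private
    k : ℕ
    k = length p

    P : Fin k → CA₁ A
    P i = ⟦ lookup p i ⟧c

    Global : Set
    Global = CA.State ⟦ p ⟧

    variable
      a : A
      x : Act A
      q q′ : Global
      ℓ : Label A k
      i j l : Fin k

    lookup∈p : ∀ i → lookup p i ∈ p
    lookup∈p i = ∈-lookup {xs = p} i

  offered-by : ∀ i → Offers (lookup p i) a → Offered p a
  offered-by i = lose (lookup∈p i)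

  active⇒moves : CA.Trans ⟦ p ⟧ q ℓ q′ → vlookup ℓ l ≡ act x → CA₁.Trans (P l) (q l) x (q′ l)
  active⇒moves {l = l} (inj₁ (i , j , _ , y , tᵢ , tⱼ , _ , ℓᵢ , ℓⱼ , idles)) e with l ≟ i | l ≟ j
  ... | yes refl | _        = subst (λ z → CA₁.Trans (P l) _ z _) (act-injective (trans (sym ℓᵢ) e)) tᵢ
  ... | no _     | yes refl = subst (λ z → CA₁.Trans (P l) _ z _) (act-injective (trans (sym ℓⱼ) e)) tⱼ
  ... | no l≢i   | no l≢j   = ⊥-elim (idle≢act (trans (sym (idles l l≢i l≢j)) e))
  active⇒moves {l = l} (inj₂ (i , y , tᵢ , _ , ℓᵢ , idles , _)) e with l ≟ i
  ... | yes refl = subst (λ z → CA₁.Trans (P l) _ z _) (act-injective (trans (sym ℓᵢ) e)) tᵢ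
  ... | no l≢i   = ⊥-elim (idle≢act (trans (sym (idles l l≢i)) e))

  run-offersIn : ∀ {w} → Run ⟦ p ⟧ q w → ∀ i → OffersIn (Offered p) (lookup w i)
  run-offersIn (step {a = ℓ} t _) zero l _ e =
    offered-by l (offer⇒Offers (lookup p l) (active⇒moves {ℓ = ℓ} t e))
  run-offersIn (step _ r)         (suc i)   = run-offersIn r i

  component-step : CA.Trans ⟦ p ⟧ q ℓ q′ → RequestsIn (Offered p) ℓ → ∀ l →
                   q′ l ≡ q l ⊎
                   Σ (Act A) λ x → CA₁.Trans (P l) (q l) x (q′ l) × (∀ {a} → x ≡ req a → Offered p a)
  component-step (inj₁ (i , j , _ , x , tᵢ , tⱼ , frame , _)) _ l with l ≟ i | l ≟ j
  ... | yes refl | _        = inj₂ (x , tᵢ , λ x≡ → offered-by j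
                                (offer⇒Offers (lookup p j) (subst (λ z → CA₁.Trans (P j) _ (co z) _) x≡ tⱼ)))
  ... | no _     | yes refl = inj₂ (co x , tⱼ , λ x≡ → offered-by i
                                (offer⇒Offers (lookup p i) (subst (λ z → CA₁.Trans (P i) _ z _) (co≡req⇒≡off x≡) tᵢ)))
  ... | no l≢i   | no l≢j   = inj₁ (frame l l≢i l≢j)
  component-step (inj₂ (i , x , tᵢ , frame , ℓᵢ , idles , _)) requests l with l ≟ i
  ... | yes refl = inj₂ (x , tᵢ , λ x≡ → requests _ (l , trans ℓᵢ (cong act x≡) , idles))
  ... | no l≢i   = inj₁ (frame l l≢i)

  run-outstanding : ∀ {w} → Run ⟦ p ⟧ q w → (∀ i → RequestsIn (Offered p) (lookup w i)) →
                    ∀ l → OutstandingIn (Offered p) (lookup p l) (q l)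
  run-outstanding (done final) _ l = outstanding-final (lookup p l) (final l)
  run-outstanding (step {a = ℓ} t r) requests l with component-step {ℓ = ℓ} t (requests zero) l
  ... | inj₁ q′l≡ql       = subst (OutstandingIn _ (lookup p l)) q′l≡ql (run-outstanding r (requests ∘ suc) l)
  ... | inj₂ (_ , tₗ , h) = outstanding-step (lookup p l) tₗ h (run-outstanding r (requests ∘ suc) l)

  weakAgreement⇒atomsOffered : AdmitsWeakAgreement ⟦ p ⟧ → AtomsOffered p
  weakAgreement⇒atomsOffered (w , run , inW) = All.tabulate atom-offered
    where
    outstanding : ∀ l → OutstandingIn (Offered p) (lookup p l) (CA₁.init (P l))
    outstanding = run-outstanding run (InW⇒requestsIn w inW (run-offersIn run))

    atom-offered : a ∈ atoms p → Offered p a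
    atom-offered a∈ with ∈-concatMap⁻ clauseAtoms {xs = p} a∈
    ... | a∈c with clauseAtom-antecedent-or-offered (lookup p (index a∈c)) (lookup-index a∈c)
    ...   | inj₁ ant = outstanding-init (lookup p (index a∈c)) (outstanding (index a∈c)) ant
    ...   | inj₂ o   = offered-by (index a∈c) o

  OfferLoopElsewhere : Fin k → A → Set
  OfferLoopElsewhere i a = Σ (Fin k) λ j → j ≢ i × ∀ s → CA₁.Trans (P j) s (off a) s

  request-paths : WellFormed p → NoStdImp p → AtomsOffered p →
                  ∀ i s → RequestPath (P i) (OfferLoopElsewhere i) s
  request-paths (_ , wfs) nsi ao i = request-path (lookup p i) (All.lookup nsi (lookup∈p i)) loop-elsewhere
    where
    loop-elsewhere : a ∈ antecedents (lookup p i) → OfferLoopElsewhere i a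
    loop-elsewhere {a} a∈ =
      index o , j≢i , offer-loop (lookup p (index o)) (All.lookup nsi (lookup∈p _)) (lookup-index o)
      where
      o : Offered p a
      o = All.lookup ao (antecedents⊆atoms (lookup∈p i) a∈)
      j≢i : index o ≢ i
      j≢i e = antecedent-not-offered (All.lookup wfs (lookup∈p i)) a∈
                (subst (λ j → Offers (lookup p j) a) e (lookup-index o))

  MatchRun : Global → Set
  MatchRun q = Σ (List (Label A k)) λ w → Run ⟦ p ⟧ q w × All (¬_ ∘ IsRequest) w

  joint-request-offer : i ≢ j → CA₁.Trans (P i) (q i) (req a) (q′ i) → CA₁.Trans (P j) (q j) (off a) (q′ j) →
                        (∀ l → l ≢ i → l ≢ j → q′ l ≡ q l) →
                        vlookup ℓ i ≡ act (req a) → vlookup ℓ j ≡ act (off a) →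
                        (∀ l → l ≢ i → l ≢ j → vlookup ℓ l ≡ idle) → CA.Trans ⟦ p ⟧ q ℓ q′
  joint-request-offer {i} {j} {a = a} i≢j tᵢ tⱼ frame ℓᵢ ℓⱼ idles with <-cmp i j
  ... | tri< i<j _ _ = inj₁ (i , j , i<j , req a , tᵢ , tⱼ , frame , ℓᵢ , ℓⱼ , idles)
  ... | tri≈ _ i≡j _ = ⊥-elim (i≢j i≡j)
  ... | tri> _ _ j<i = inj₁ (j , i , j<i , off a , tⱼ , tᵢ , flip ∘ frame , ℓⱼ , ℓᵢ , flip ∘ idles)

  match-step : ∀ {s} → j ≢ i → CA₁.Trans (P i) (q i) (req a) s → (∀ r → CA₁.Trans (P j) r (off a) r) →
               CA.Trans ⟦ p ⟧ q (matchLabel i j (req a) (off a)) (update q i s)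
  match-step {j} {i} {q} {a} {s} j≢i t loop =
    joint-request-offer {ℓ = matchLabel i j (req a) (off a)} (j≢i ∘ sym)
      (subst (CA₁.Trans (P i) (q i) (req a)) (sym (update-same {q = q} {i = i})) t)
      (subst (CA₁.Trans (P j) (q j) (off a)) (sym (update-other j≢i)) (loop (q j)))
      (λ _ l≢i _ → update-other l≢i)
      (matchLabel-i (j≢i ∘ sym)) (matchLabel-j {i = i}) (λ _ → matchLabel-idle)

  discharge : ∀ i q {sᵢ} → q i ≡ sᵢ → RequestPath (P i) (OfferLoopElsewhere i) sᵢ →
              (∀ q′ → CA₁.Final (P i) (q′ i) → (∀ l → l ≢ i → q′ l ≡ q l) → MatchRun q′) → MatchRun q
  discharge i q refl (arrived final) continue = continue q final (λ _ _ → refl)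
  discharge i q refl (request {s′ = s} {a} t (j , j≢i , loop) rest) continue =
    let w , run , matches =
          discharge i (update q i s) (update-same {q = q} {i = i}) rest
            (λ q′ final frame → continue q′ final (λ l l≢i → trans (frame l l≢i) (update-other l≢i)))
    in matchLabel i j (req a) (off a) ∷ w , step (match-step j≢i t loop) run ,
       matchLabel-¬IsRequest (j≢i ∘ sym) ∷ matches

  match-run : (∀ i s → RequestPath (P i) (OfferLoopElsewhere i) s) →
              (is : List (Fin k)) (q : Global) → (∀ l → ¬ l ∈ is → CA₁.Final (P l) (q l)) → MatchRun q
  match-run _     []       q final = [] , done (λ l → final l λ ()) , []
  match-run paths (i ∷ is) q final = discharge i q refl (paths i (q i)) continue
    where
    continue : ∀ q′ → CA₁.Final (P i) (q′ i) → (∀ l → l ≢ i → q′ l ≡ q l) → MatchRun q′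
    continue q′ finalᵢ frame = match-run paths is q′ final′
      where
      final′ : ∀ l → ¬ l ∈ is → CA₁.Final (P l) (q′ l)
      final′ l l∉is with l ≟ i
      ... | yes refl = finalᵢ
      ... | no l≢i   = subst (CA₁.Final (P l)) (sym (frame l l≢i))
                             (final l λ { (here l≡i) → l≢i l≡i ; (there l∈is) → l∉is l∈is })

  atomsOffered⇒weakAgreement : WellFormed p → NoStdImp p → AtomsOffered p → AdmitsWeakAgreement ⟦ p ⟧
  atomsOffered⇒weakAgreement wf nsi ao =
    let w , run , matches = match-run (request-paths wf nsi ao) (allFin k) (CA.init ⟦ p ⟧)
                                      (λ l l∉ → ⊥-elim (l∉ (∈-allFin l)))
        ¬request : ∀ i → ¬ IsRequest (lookup w i)
        ¬request i = All.lookup matches (∈-lookup i)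
    in w , run , proj₁ wf , (λ i → i) ,
       (λ i r → ⊥-elim (¬request i r)) , (λ i _ r _ _ → ⊥-elim (¬request i r))

  weakAgreement⇔atomsOffered : WellFormed p → NoStdImp p → AdmitsWeakAgreement ⟦ p ⟧ ⇔ AtomsOffered p
  weakAgreement⇔atomsOffered wf nsi = mk⇔ weakAgreement⇒atomsOffered (atomsOffered⇒weakAgreement wf nsi)

theorem5p9 : {A : Set} (p : HPCL A) → WellFormed p → NoStdImp p →
    ([ toPCL p ] ⊢ λF p) ⇔ AdmitsWeakAgreement ⟦ p ⟧
theorem5p9 p wf nsi = ⇔.trans (⊢λ⇔atomsOffered p nsi) (⇔.sym (weakAgreement⇔atomsOffered p wf nsi))
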